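{- For every non-negative integer $N$, \[\sum_{\pi\in\mathcal{D}_{\le N}} q^{\mathcal{E}(\pi)} = \sum_{\pi\in\mathcal{RR}_{\le N-1}} \hat{\omega}(\pi)\, q^{|\pi|},\] where for $\pi=(\lambda_1,\dots,\lambda_k)$ with $k\ge1$ parts, $\hat{\omega}(\pi)=(N-\lambda_1)\,\lambda_k\prod_{i=1}^{k-1}(\lambda_i-\lambda_{i+1}-1)$, and $\hat{\omega}(\emptyset)=N+1$.
   Context: A partition $\pi=(\lambda_1,\lambda_2,\dots)$ is a finite non-increasing sequence of positive integers; the empty sequence is the unique partition of $0$; $|\pi|$ is the sum of its parts. $\mathcal{D}_{\le N}$ is the set of partitions into distinct parts all $\le N$. $\mathcal{RR}_{\le M}$ is the set of partitions into parts $\le M$ in which consecutive parts differ by at least $2$. $\mathcal{E}(\pi)=\lambda_2+\lambda_4+\lambda_6+\cdots$. -}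

module Defs where

open import Data.Nat using (ℕ; zero; suc; _+_; _*_; _∸_; _≤_; _<_; _>_; _≥_)
open import Data.Nat.Properties using (_≤?_; _<?_)
open import Data.List using (List; []; _∷_; map; concatMap; applyUpTo; filter)
open import Data.Nat.ListAction using (sum)
open import Data.List.Relation.Unary.All using (All; all?)
open import Data.List.Relation.Unary.Linked using (Linked; linked?)
open import Data.Product using (_×_)
open import Relation.Nullary.Decidable using (Dec; _×-dec_)
open import Data.Bool using (if_then_else_)
open import Data.Nat using (_≡ᵇ_)

Partition : Set
Partition = List ℕ

IsPartition : Partition → Set
IsPartition π = All (0 <_) π × Linked _≥_ π

size : Partition → ℕ
size = sum

InD : ℕ → Partition → Set
InD N π = IsPartition π × Linked _>_ π × All (_≤ N) π

Gap2 : ℕ → ℕ → Set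
Gap2 a b = b + 2 ≤ a

InRR : ℕ → Partition → Set
InRR M π = IsPartition π × Linked Gap2 π × All (_≤ M) π

E : Partition → ℕ
E []            = 0
E (_ ∷ [])      = 0
E (_ ∷ y ∷ r)   = y + E r

-- ∏_{i=1}^{k-1} (λᵢ - λᵢ₊₁ - 1) * λ_k   (for a nonempty list)
gapProdLast : ℕ → List ℕ → ℕ
gapProdLast x []       = x
gapProdLast x (y ∷ r)  = (x ∸ y ∸ 1) * gapProdLast y r

ωhat : ℕ → Partition → ℕ
ωhat N []        = suc N
ωhat N (x ∷ r)   = (N ∸ x) * gapProdLast x r

-- Finite search space: all lists of length ≤ L with entries in {1,…,B},
-- each occurring exactly once.
lists : ℕ → ℕ → List (List ℕ)
lists zero    B = [] ∷ []
lists (suc L) B = [] ∷ concatMap (λ x → map (x ∷_) (lists L B)) (applyUpTo suc B)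

InD? : (N : ℕ) → (π : Partition) → Dec (InD N π)
InD? N π = ((all? (0 <?_) π) ×-dec (linked? (λ a b → b ≤? a) π))
           ×-dec (linked? (λ a b → b <? a) π ×-dec all? (_≤? N) π)

InRR? : (M : ℕ) → (π : Partition) → Dec (InRR M π)
InRR? M π = ((all? (0 <?_) π) ×-dec (linked? (λ a b → b ≤? a) π))
            ×-dec (linked? (λ a b → b + 2 ≤? a) π ×-dec all? (_≤? M) π)

-- The set 𝓓_{≤N} as a duplicate-free list (a partition into distinct parts ≤ N has ≤ N parts)
Dset : ℕ → List Partition
Dset N = filter (InD? N) (lists N N)

-- The set 𝓡𝓡_{≤M} as a duplicate-free list (at most M parts)
RRset : ℕ → List Partition
RRset M = filter (InRR? M) (lists M M)

-- coefficient of qⁿ in  Σ_{π ∈ S} w(π) q^{e(π)}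
coeff : List Partition → (Partition → ℕ) → (Partition → ℕ) → ℕ → ℕ
coeff S w e n = sum (map (λ π → if e π ≡ᵇ n then w π else 0) S)

-- Write A_b, C_b for the generating functions of q^{λ₂+λ₄+⋯} and q^{λ₁+λ₃+⋯}
-- over 𝒟_{≤b}.  Splitting off a largest part b+1 gives A_{b+1} = A_b + C_b and
-- C_{b+1} = C_b + q^{b+1} A_b.  On the other side let P_b = Σ ω̂_b(π) q^{|π|} and
-- Q_b = Σ w(π) q^{|π|}, both over 𝓡𝓡_{≤b-1}, where ω̂_b(π) = (b-λ₁) w(π).  The
-- factor b-λ₁ vanishes on partitions with largest part b and grows by one with b,
-- so P_{b+1} = P_b + Q_{b+1}; splitting off a largest part b+1 gives
-- Q_{b+2} = Q_{b+1} + q^{b+1} P_b.  Hence A_b = P_b and C_b = Q_{b+1} by induction.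
module Submission where

open import Defs
open import Data.Nat using (ℕ; zero; suc; _+_; _*_; _∸_; _≤_; _<_; _>_; z≤n; s≤s; z<s; s<s; _≡ᵇ_)
open import Data.Nat.Properties
open import Data.Nat.ListAction using (sum)
open import Data.Nat.ListAction.Properties using (sum-++)
open import Data.List using (List; []; _∷_; _++_; map; concat; concatMap; applyUpTo; filter)
open import Data.List.Properties
  using (map-++; map-∘; map-cong; map-cong-local; concat-++; ++-identityʳ; applyUpTo-∷ʳ; map-applyUpTo;
         filter-accept; filter-none; filter-≐; filter-++)
open import Data.List.Relation.Unary.All as All using (All; []; _∷_)
open import Data.List.Relation.Unary.All.Properties using (++⁺; map⁺)
open import Data.List.Relation.Unary.Linked as Linked using (Linked; []; [-]; _∷_)
open import Data.List.Relation.Unary.Linked.Properties using (Linked⇒All)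
open import Data.Bool using (Bool; true; false; if_then_else_)
open import Data.Product using (_×_; _,_; proj₁; proj₂; uncurry)
open import Data.Empty using (⊥-elim)
open import Function using (_∘_)
open import Relation.Nullary using (does)
open import Relation.Unary using (Decidable)
open import Relation.Binary using (Transitive)
open import Relation.Binary.PropositionalEquality using (_≡_; refl; sym; trans; cong; cong₂; subst)
open import Algebra.Properties.CommutativeSemigroup +-commutativeSemigroup using (interchange)
open Relation.Binary.PropositionalEquality.≡-Reasoning

private
  variable
    A B : Set

filter-map : {P : B → Set} (P? : Decidable P) (f : A → B) (xs : List A) →
             filter P? (map f xs) ≡ map f (filter (P? ∘ f) xs)
filter-map P? f [] = refl
filter-map P? f (x ∷ xs) with does (P? (f x))
... | true  = cong (f x ∷_) (filter-map P? f xs)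
... | false = filter-map P? f xs

filter-concatMap : {P : B → Set} (P? : Decidable P) (g : A → List B) (xs : List A) →
                   filter P? (concatMap g xs) ≡ concatMap (filter P? ∘ g) xs
filter-concatMap P? g [] = refl
filter-concatMap P? g (x ∷ xs) =
  trans (filter-++ P? (g x) (concatMap g xs)) (cong (filter P? (g x) ++_) (filter-concatMap P? g xs))

concat-applyUpTo-suc : (h : ℕ → List A) (n : ℕ) → concat (applyUpTo h (suc n)) ≡ concat (applyUpTo h n) ++ h n
concat-applyUpTo-suc h n = begin
  concat (applyUpTo h (suc n))               ≡⟨ cong concat (sym (applyUpTo-∷ʳ h n)) ⟩
  concat (applyUpTo h n ++ h n ∷ [])         ≡⟨ sym (concat-++ (applyUpTo h n) (h n ∷ [])) ⟩
  concat (applyUpTo h n) ++ (h n ++ [])      ≡⟨ cong (concat (applyUpTo h n) ++_) (++-identityʳ (h n)) ⟩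
  concat (applyUpTo h n) ++ h n              ∎

concat-applyUpTo-truncate : ∀ {a m} (g h : ℕ → List A) → a ≤ m →
  (∀ {i} → i < a → g i ≡ h i) → (∀ {i} → a ≤ i → g i ≡ []) →
  concat (applyUpTo g m) ≡ concat (applyUpTo h a)
concat-applyUpTo-truncate {a = zero} {zero} g h _ _ _ = refl
concat-applyUpTo-truncate {a = zero} {suc m} g h _ _ g≡[] =
  cong₂ _++_ (g≡[] z≤n) (concat-applyUpTo-truncate {m = m} (g ∘ suc) h z≤n (λ ()) (λ _ → g≡[] z≤n))
concat-applyUpTo-truncate {a = suc a} {suc m} g h (s≤s a≤m) g≡h g≡[] =
  cong₂ _++_ (g≡h z<s) (concat-applyUpTo-truncate (g ∘ suc) (h ∘ suc) a≤m (g≡h ∘ s<s) (g≡[] ∘ s≤s))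

linked-∷⁺ : ∀ {R : ℕ → ℕ → Set} {x xs} → All (R x) xs → Linked R xs → Linked R (x ∷ xs)
linked-∷⁺ []        _   = [-]
linked-∷⁺ (Rxy ∷ _) Rxs = Rxy ∷ Rxs

linked-∷⁻ : ∀ {R : ℕ → ℕ → Set} {x xs} → Transitive R → Linked R (x ∷ xs) → All (R x) xs
linked-∷⁻ _     [-]         = []
linked-∷⁻ trans (Rxy ∷ Rxs) = Linked⇒All trans Rxy Rxs

-- Filtering the candidates `lists L B` by a predicate that is determined by its
-- largest part reproduces, in the same order, the recursive enumeration `enum`.
module HeadRecursive
  {P : ℕ → Partition → Set} (P? : ∀ a → Decidable (P a))
  (below : ℕ → ℕ) (below≤ : ∀ i → below i ≤ i)
  (P-[] : ∀ {a} → P a [])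
  (P-∷⁻ : ∀ {a i π} → P a (suc i ∷ π) → i < a × P (below i) π)
  (P-∷⁺ : ∀ {a i π} → i < a → P (below i) π → P a (suc i ∷ π))
  (enum : ℕ → List Partition)
  (enum-zero : enum 0 ≡ [] ∷ [])
  (enum-suc : ∀ a → enum (suc a) ≡ enum a ++ map (suc a ∷_) (enum (below a)))
  where

  branch : ℕ → List Partition
  branch i = map (suc i ∷_) (enum (below i))

  enum-unfold : ∀ a → enum a ≡ [] ∷ concat (applyUpTo branch a)
  enum-unfold zero    = enum-zero
  enum-unfold (suc a) = begin
    enum (suc a)                                          ≡⟨ enum-suc a ⟩
    enum a ++ branch a                                    ≡⟨ cong (_++ branch a) (enum-unfold a) ⟩
    [] ∷ (concat (applyUpTo branch a) ++ branch a)        ≡⟨ cong ([] ∷_) (sym (concat-applyUpTo-suc branch a)) ⟩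
    [] ∷ concat (applyUpTo branch (suc a))                ∎

  filter-lists : ∀ L B a → a ≤ L → a ≤ B → filter (P? a) (lists L B) ≡ enum a
  filter-lists zero    B zero _ _ = trans (filter-accept (P? 0) P-[]) (sym enum-zero)
  filter-lists (suc L) B a a≤L a≤B = begin
    filter (P? a) (lists (suc L) B)
      ≡⟨ filter-accept (P? a) P-[] ⟩
    [] ∷ filter (P? a) (concatMap candidates (applyUpTo suc B))
      ≡⟨ cong ([] ∷_) (filter-concatMap (P? a) candidates (applyUpTo suc B)) ⟩
    [] ∷ concat (map (filter (P? a) ∘ candidates) (applyUpTo suc B))
      ≡⟨ cong (([] ∷_) ∘ concat) (map-applyUpTo suc (filter (P? a) ∘ candidates) B) ⟩
    [] ∷ concat (applyUpTo (filter (P? a) ∘ candidates ∘ suc) B)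
      ≡⟨ cong ([] ∷_) (concat-applyUpTo-truncate _ branch a≤B accepted rejected) ⟩
    [] ∷ concat (applyUpTo branch a)
      ≡⟨ sym (enum-unfold a) ⟩
    enum a ∎
    where
    candidates : ℕ → List Partition
    candidates x = map (x ∷_) (lists L B)

    accepted : ∀ {i} → i < a → filter (P? a) (candidates (suc i)) ≡ branch i
    accepted {i} i<a = begin
      filter (P? a) (candidates (suc i))
        ≡⟨ filter-map (P? a) (suc i ∷_) (lists L B) ⟩
      map (suc i ∷_) (filter (P? a ∘ (suc i ∷_)) (lists L B))
        ≡⟨ cong (map (suc i ∷_)) (filter-≐ (P? a ∘ (suc i ∷_)) (P? (below i)) (proj₂ ∘ P-∷⁻ , P-∷⁺ i<a) (lists L B)) ⟩
      map (suc i ∷_) (filter (P? (below i)) (lists L B))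
        ≡⟨ cong (map (suc i ∷_)) (filter-lists L B (below i) (≤-pred (≤-trans (s≤s (below≤ i)) (≤-trans i<a a≤L)))
                                                     (≤-trans (below≤ i) (≤-trans (<⇒≤ i<a) a≤B))) ⟩
      branch i ∎

    rejected : ∀ {i} → a ≤ i → filter (P? a) (candidates (suc i)) ≡ []
    rejected {i} a≤i = trans (filter-map (P? a) (suc i ∷_) (lists L B))
      (cong (map (suc i ∷_)) (filter-none (P? a ∘ (suc i ∷_)) (All.universal (λ _ p → <⇒≱ (proj₁ (P-∷⁻ p)) a≤i) (lists L B))))

distinctUpTo : ℕ → List Partition
distinctUpTo zero    = [] ∷ []
distinctUpTo (suc a) = distinctUpTo a ++ map (suc a ∷_) (distinctUpTo a)

gapTwoBelow : ℕ → List Partition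
gapTwoBelow zero          = [] ∷ []
gapTwoBelow (suc zero)    = [] ∷ []
gapTwoBelow (suc (suc c)) = gapTwoBelow (suc c) ++ map (suc c ∷_) (gapTwoBelow c)

gapTwoBelow-suc-pred : ∀ b → gapTwoBelow (suc (b ∸ 1)) ≡ gapTwoBelow b
gapTwoBelow-suc-pred zero    = refl
gapTwoBelow-suc-pred (suc b) = refl

gapTwoBelow-bounded : ∀ b → All (All (_< b)) (gapTwoBelow b)
gapTwoBelow-bounded zero          = [] ∷ []
gapTwoBelow-bounded (suc zero)    = [] ∷ []
gapTwoBelow-bounded (suc (suc c)) =
  ++⁺ (All.map (All.map m<n⇒m<1+n) (gapTwoBelow-bounded (suc c)))
      (map⁺ (All.map (λ ps → n<1+n (suc c) ∷ All.map (m<n⇒m<1+n ∘ m<n⇒m<1+n) ps) (gapTwoBelow-bounded c)))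

>-trans : Transitive _>_
>-trans x>y y>z = <-trans y>z x>y

InD-∷⁻ : ∀ {a i π} → InD a (suc i ∷ π) → i < a × InD i π
InD-∷⁻ ((_ ∷ pos , ≥-lk) , >-lk , i<a ∷ _) =
  i<a , (pos , Linked.tail ≥-lk) , Linked.tail >-lk , All.map ≤-pred (linked-∷⁻ >-trans >-lk)

InD-∷⁺ : ∀ {a i π} → i < a → InD i π → InD a (suc i ∷ π)
InD-∷⁺ i<a ((pos , ≥-lk) , >-lk , ≤i) =
  (z<s ∷ pos , linked-∷⁺ (All.map m≤n⇒m≤1+n ≤i) ≥-lk) ,
  linked-∷⁺ (All.map s≤s ≤i) >-lk ,
  i<a ∷ All.map (λ z≤i → ≤-trans z≤i (<⇒≤ i<a)) ≤i

Gap2-trans : Transitive Gap2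
Gap2-trans {_} {b} b+2≤a c+2≤b = ≤-trans c+2≤b (≤-trans (m≤m+n b 2) b+2≤a)

Gap2⇒≤∸1 : ∀ {z} i → Gap2 (suc i) z → z ≤ i ∸ 1
Gap2⇒≤∸1 {z} i z+2≤ = ∸-monoˡ-≤ 1 (≤-pred (subst (_≤ suc i) (+-comm z 2) z+2≤))

≤∸1⇒Gap2 : ∀ {z} i → 0 < z → z ≤ i ∸ 1 → Gap2 (suc i) z
≤∸1⇒Gap2 zero    0<z z≤0 = ⊥-elim (<⇒≱ 0<z z≤0)
≤∸1⇒Gap2 {z} (suc i) _ z≤i = subst (_≤ suc (suc i)) (+-comm 2 z) (s≤s (s≤s z≤i))

InRR-∷⁻ : ∀ {a i π} → InRR a (suc i ∷ π) → i < a × InRR (i ∸ 1) π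
InRR-∷⁻ {i = i} ((_ ∷ pos , ≥-lk) , gap-lk , i<a ∷ _) =
  i<a , (pos , Linked.tail ≥-lk) , Linked.tail gap-lk , All.map (Gap2⇒≤∸1 i) (linked-∷⁻ Gap2-trans gap-lk)

InRR-∷⁺ : ∀ {a i π} → i < a → InRR (i ∸ 1) π → InRR a (suc i ∷ π)
InRR-∷⁺ {i = i} i<a ((pos , ≥-lk) , gap-lk , ≤i∸1) =
  (z<s ∷ pos , linked-∷⁺ (All.map (λ z≤ → ≤-trans z≤ (≤-trans (m∸n≤m i 1) (n≤1+n i))) ≤i∸1) ≥-lk) ,
  linked-∷⁺ (All.zipWith (uncurry (≤∸1⇒Gap2 i)) (pos , ≤i∸1)) gap-lk ,
  i<a ∷ All.map (λ z≤ → ≤-trans z≤ (≤-trans (m∸n≤m i 1) (<⇒≤ i<a))) ≤i∸1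

Dset≡distinctUpTo : ∀ N → Dset N ≡ distinctUpTo N
Dset≡distinctUpTo N = filter-lists N N N ≤-refl ≤-refl
  where
  open HeadRecursive InD? (λ i → i) (λ _ → ≤-refl)
    (([] , []) , [] , []) InD-∷⁻ InD-∷⁺ distinctUpTo refl (λ _ → refl)

RRset≡gapTwoBelow : ∀ M → RRset M ≡ gapTwoBelow (suc M)
RRset≡gapTwoBelow M = filter-lists M M M ≤-refl ≤-refl
  where
  enum-suc : ∀ a → gapTwoBelow (suc (suc a)) ≡ gapTwoBelow (suc a) ++ map (suc a ∷_) (gapTwoBelow (suc (a ∸ 1)))
  enum-suc zero    = refl
  enum-suc (suc a) = refl
  open HeadRecursive InRR? (_∸ 1) (λ i → m∸n≤m i 1)
    (([] , []) , [] , []) InRR-∷⁻ InRR-∷⁺ (gapTwoBelow ∘ suc) refl enum-suc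

coeff-++ : ∀ S T w e n → coeff (S ++ T) w e n ≡ coeff S w e n + coeff T w e n
coeff-++ S T w e n = trans (cong sum (map-++ _ S T)) (sum-++ (map _ S) (map _ T))

coeff-map : ∀ (f : Partition → Partition) S w e n → coeff (map f S) w e n ≡ coeff S (w ∘ f) (e ∘ f) n
coeff-map f S w e n = cong sum (sym (map-∘ S))

coeff-congʷ : ∀ {S w w′} e n → All (λ π → w π ≡ w′ π) S → coeff S w e n ≡ coeff S w′ e n
coeff-congʷ e n w≡w′ = cong sum (map-cong-local (All.map (λ {π} → cong (if e π ≡ᵇ n then_else 0)) w≡w′))

coeff-congᵉ : ∀ S w {e e′} n → (∀ π → e π ≡ e′ π) → coeff S w e n ≡ coeff S w e′ n
coeff-congᵉ S w n e≡e′ = cong sum (map-cong (λ π → cong (λ m → if m ≡ᵇ n then w π else 0) (e≡e′ π)) S)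

if-+ : ∀ (b : Bool) u v → (if b then u + v else 0) ≡ (if b then u else 0) + (if b then v else 0)
if-+ true  u v = refl
if-+ false u v = refl

coeff-+ʷ : ∀ S w w′ e n → coeff S (λ π → w π + w′ π) e n ≡ coeff S w e n + coeff S w′ e n
coeff-+ʷ []      w w′ e n = refl
coeff-+ʷ (π ∷ S) w w′ e n = begin
  (if b then w π + w′ π else 0) + coeff S (λ ρ → w ρ + w′ ρ) e n
    ≡⟨ cong₂ _+_ (if-+ b (w π) (w′ π)) (coeff-+ʷ S w w′ e n) ⟩
  ((if b then w π else 0) + (if b then w′ π else 0)) + (coeff S w e n + coeff S w′ e n)
    ≡⟨ interchange (if b then w π else 0) (if b then w′ π else 0) (coeff S w e n) (coeff S w′ e n) ⟩
  ((if b then w π else 0) + coeff S w e n) + ((if b then w′ π else 0) + coeff S w′ e n) ∎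
  where b = e π ≡ᵇ n

coeff-zeroʷ : ∀ S w e n → (∀ π → w π ≡ 0) → coeff S w e n ≡ 0
coeff-zeroʷ []      w e n w≡0 = refl
coeff-zeroʷ (π ∷ S) w e n w≡0 with e π ≡ᵇ n
... | true  = cong₂ _+_ (w≡0 π) (coeff-zeroʷ S w e n w≡0)
... | false = coeff-zeroʷ S w e n w≡0

oddSum : Partition → ℕ
oddSum []      = 0
oddSum (x ∷ π) = x + E π

E-∷ : ∀ x π → E (x ∷ π) ≡ oddSum π
E-∷ x []      = refl
E-∷ x (y ∷ π) = refl

gapWeight : Partition → ℕ
gapWeight []      = 1
gapWeight (x ∷ π) = gapProdLast x π

gapProdLast-suc : ∀ b π → gapProdLast (suc b) π ≡ ωhat b π
gapProdLast-suc b []      = refl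
gapProdLast-suc b (x ∷ π) =
  cong (_* gapProdLast x π) (trans (∸-+-assoc (suc b) x 1) (cong (suc b ∸_) (+-comm x 1)))

ωhat-suc : ∀ {b} π → All (_< suc b) π → ωhat (suc b) π ≡ ωhat b π + gapWeight π
ωhat-suc {b} []      _           = sym (+-comm (suc b) 1)
ωhat-suc {b} (x ∷ π) (x<1+b ∷ _) = begin
  (suc b ∸ x) * g        ≡⟨ cong (_* g) (+-∸-assoc 1 (≤-pred x<1+b)) ⟩
  g + (b ∸ x) * g        ≡⟨ +-comm g _ ⟩
  (b ∸ x) * g + g        ∎
  where g = gapProdLast x π

ωhat-vanishes : ∀ b π → ωhat b (b ∷ π) ≡ 0
ωhat-vanishes b π = cong (_* gapProdLast b π) (n∸n≡0 b)

coeff-ωhat-gapTwoBelow-suc : ∀ b e n → coeff (gapTwoBelow (suc b)) (ωhat b) e n ≡ coeff (gapTwoBelow b) (ωhat b) e n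
coeff-ωhat-gapTwoBelow-suc zero    e n = refl
coeff-ωhat-gapTwoBelow-suc (suc c) e n = begin
  coeff (gapTwoBelow (suc c) ++ map (suc c ∷_) (gapTwoBelow c)) ω e n
    ≡⟨ coeff-++ (gapTwoBelow (suc c)) (map (suc c ∷_) (gapTwoBelow c)) ω e n ⟩
  coeff (gapTwoBelow (suc c)) ω e n + coeff (map (suc c ∷_) (gapTwoBelow c)) ω e n
    ≡⟨ cong (coeff (gapTwoBelow (suc c)) ω e n +_) (trans (coeff-map (suc c ∷_) (gapTwoBelow c) ω e n)
                                                        (coeff-zeroʷ (gapTwoBelow c) (ω ∘ (suc c ∷_)) (e ∘ (suc c ∷_)) n (ωhat-vanishes (suc c)))) ⟩
  coeff (gapTwoBelow (suc c)) ω e n + 0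
    ≡⟨ +-identityʳ _ ⟩
  coeff (gapTwoBelow (suc c)) ω e n ∎
  where ω = ωhat (suc c)

-- The argument k stands for a factor q^k: `… b k n` is the coefficient of qⁿ in q^k
-- times the series, so shifts never need truncated subtraction.
evenSeries oddSeries ωSeries gapSeries : ℕ → ℕ → ℕ → ℕ
evenSeries b k n = coeff (distinctUpTo b) (λ _ → 1) (λ π → k + E π) n
oddSeries  b k n = coeff (distinctUpTo b) (λ _ → 1) (λ π → k + oddSum π) n
ωSeries    b k n = coeff (gapTwoBelow b) (ωhat b) (λ π → k + size π) n
gapSeries  b k n = coeff (gapTwoBelow b) gapWeight (λ π → k + size π) n

evenSeries-suc : ∀ b k n → evenSeries (suc b) k n ≡ evenSeries b k n + oddSeries b k n
evenSeries-suc b k n = trans (coeff-++ D (map (suc b ∷_) D) one e n) (cong (evenSeries b k n +_)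
  (trans (coeff-map (suc b ∷_) D one e n) (coeff-congᵉ D one n (λ π → cong (k +_) (E-∷ (suc b) π)))))
  where
  D = distinctUpTo b
  one = λ (_ : Partition) → 1
  e = λ π → k + E π

oddSeries-suc : ∀ b k n → oddSeries (suc b) k n ≡ oddSeries b k n + evenSeries b (k + suc b) n
oddSeries-suc b k n = trans (coeff-++ D (map (suc b ∷_) D) one e n) (cong (oddSeries b k n +_)
  (trans (coeff-map (suc b ∷_) D one e n) (coeff-congᵉ D one n (λ π → sym (+-assoc k (suc b) (E π))))))
  where
  D = distinctUpTo b
  one = λ (_ : Partition) → 1
  e = λ π → k + oddSum π

ωSeries-suc : ∀ b k n → ωSeries (suc b) k n ≡ ωSeries b k n + gapSeries (suc b) k n
ωSeries-suc b k n = begin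
  coeff S (ωhat (suc b)) e n
    ≡⟨ coeff-congʷ e n (All.map (ωhat-suc _) (gapTwoBelow-bounded (suc b))) ⟩
  coeff S (λ π → ωhat b π + gapWeight π) e n
    ≡⟨ coeff-+ʷ S (ωhat b) gapWeight e n ⟩
  coeff S (ωhat b) e n + gapSeries (suc b) k n
    ≡⟨ cong (_+ gapSeries (suc b) k n) (coeff-ωhat-gapTwoBelow-suc b e n) ⟩
  ωSeries b k n + gapSeries (suc b) k n ∎
  where
  S = gapTwoBelow (suc b)
  e = λ π → k + size π

gapSeries-suc : ∀ b k n → gapSeries (suc (suc b)) k n ≡ gapSeries (suc b) k n + ωSeries b (k + suc b) n
gapSeries-suc b k n = trans (coeff-++ (gapTwoBelow (suc b)) _ gapWeight e n) (cong (gapSeries (suc b) k n +_) (begin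
  coeff (map (suc b ∷_) (gapTwoBelow b)) gapWeight e n
    ≡⟨ coeff-map (suc b ∷_) (gapTwoBelow b) gapWeight e n ⟩
  coeff (gapTwoBelow b) (gapProdLast (suc b)) (λ π → k + (suc b + size π)) n
    ≡⟨ coeff-congʷ (λ π → k + (suc b + size π)) n (All.universal (gapProdLast-suc b) (gapTwoBelow b)) ⟩
  coeff (gapTwoBelow b) (ωhat b) (λ π → k + (suc b + size π)) n
    ≡⟨ coeff-congᵉ (gapTwoBelow b) (ωhat b) n (λ π → sym (+-assoc k (suc b) (size π))) ⟩
  ωSeries b (k + suc b) n ∎))
  where
  e = λ π → k + size π

series-agree : ∀ b → (∀ k n → evenSeries b k n ≡ ωSeries b k n)
                   × (∀ k n → oddSeries b k n ≡ gapSeries (suc b) k n)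
series-agree zero    = (λ _ _ → refl) , (λ _ _ → refl)
series-agree (suc b) = even≡ω′ , odd≡gap′
  where
  even≡ω = proj₁ (series-agree b)
  odd≡gap = proj₂ (series-agree b)

  even≡ω′ : ∀ k n → evenSeries (suc b) k n ≡ ωSeries (suc b) k n
  even≡ω′ k n = begin
    evenSeries (suc b) k n                       ≡⟨ evenSeries-suc b k n ⟩
    evenSeries b k n + oddSeries b k n           ≡⟨ cong₂ _+_ (even≡ω k n) (odd≡gap k n) ⟩
    ωSeries b k n + gapSeries (suc b) k n        ≡⟨ sym (ωSeries-suc b k n) ⟩
    ωSeries (suc b) k n                          ∎

  odd≡gap′ : ∀ k n → oddSeries (suc b) k n ≡ gapSeries (suc (suc b)) k n
  odd≡gap′ k n = begin
    oddSeries (suc b) k n                              ≡⟨ oddSeries-suc b k n ⟩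
    oddSeries b k n + evenSeries b (k + suc b) n       ≡⟨ cong₂ _+_ (odd≡gap k n) (even≡ω (k + suc b) n) ⟩
    gapSeries (suc b) k n + ωSeries b (k + suc b) n    ≡⟨ sym (gapSeries-suc b k n) ⟩
    gapSeries (suc (suc b)) k n                        ∎

theorem6p3 : (N n : ℕ) →
    coeff (Dset N) (λ _ → 1) E n ≡ coeff (RRset (N ∸ 1)) (ωhat N) size n
theorem6p3 N n = begin
  coeff (Dset N) (λ _ → 1) E n             ≡⟨ cong (λ S → coeff S (λ _ → 1) E n) (Dset≡distinctUpTo N) ⟩
  evenSeries N 0 n                         ≡⟨ proj₁ (series-agree N) 0 n ⟩
  ωSeries N 0 n                            ≡⟨ cong (λ S → coeff S (ωhat N) size n) (sym RRset≡) ⟩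
  coeff (RRset (N ∸ 1)) (ωhat N) size n    ∎
  where
  RRset≡ : RRset (N ∸ 1) ≡ gapTwoBelow N
  RRset≡ = trans (RRset≡gapTwoBelow (N ∸ 1)) (gapTwoBelow-suc-pred N)
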